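{- For every $k\in\mathbb{N}$, every path has a consistent $(k+1\!:\!k)$-colouring with clustering $k$.
   Context: A $(p\!:\!q)$-colouring $\alpha$ assigns to each vertex a $q$-subset of a palette of $p$ colours. It is consistent if for each vertex $x$ there is an ordering $\alpha_x^1,\dots,\alpha_x^q$ of $\alpha(x)$ such that $\alpha_x^i\ne\alpha_y^j$ for every edge $xy$ and all distinct $i,j\in[1,q]$. A monochromatic component for colour $\beta$ is a connected component of the subgraph induced by the vertices whose set contains $\beta$; clustering $c$ means every monochromatic component has at most $c$ vertices. -}

module Defs where

open import Data.Nat using (ℕ; suc; _≤_)
open import Data.Fin using (Fin; toℕ)
open import Data.Fin.Subset using (Subset; _∈_; ∣_∣)
open import Data.List using (List; length)
open import Data.List.Relation.Unary.All using (All)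
open import Data.List.Relation.Unary.Unique.Propositional using (Unique)
open import Data.Product using (Σ; ∃; _×_; _,_)
open import Data.Sum using (_⊎_)
open import Function.Definitions using (Injective)
open import Relation.Binary.PropositionalEquality using (_≡_; _≢_)
open import Relation.Nullary using (¬_)

record Graph : Set₁ where
  field
    n     : ℕ
    Adj   : Fin n → Fin n → Set
    adj-sym : ∀ {x y} → Adj x y → Adj y x
    irrefl : ∀ {x} → ¬ Adj x x
open Graph public

pathAdj : (m : ℕ) → Fin m → Fin m → Set
pathAdj m i j = (toℕ j ≡ suc (toℕ i)) ⊎ (toℕ i ≡ suc (toℕ j))

Path : ℕ → Graph
Path m = record
  { n = m
  ; Adj = pathAdj m
  ; adj-sym = λ { (Data.Sum.inj₁ e) → Data.Sum.inj₂ e ; (Data.Sum.inj₂ e) → Data.Sum.inj₁ e }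
  ; irrefl = irr
  }
  where
  open import Data.Nat.Properties using (1+n≢n)
  open import Relation.Binary.PropositionalEquality using (sym)
  irr : ∀ {x} → ¬ pathAdj m x x
  irr {x} (Data.Sum.inj₁ e) = 1+n≢n (sym e)
  irr {x} (Data.Sum.inj₂ e) = 1+n≢n (sym e)

record Colouring (G : Graph) (p q : ℕ) : Set where
  field
    col  : Fin (n G) → Subset p
    size : ∀ x → ∣ col x ∣ ≡ q
open Colouring public

-- An ordering α_x^1..α_x^q of the set S (a bijection Fin q → S).
IsOrdering : ∀ {p q} → Subset p → (Fin q → Fin p) → Set
IsOrdering {p} S σ = Injective _≡_ _≡_ σ × (∀ (c : Fin p) → c ∈ S → ∃ λ i → σ i ≡ c)
                                         × (∀ i → σ i ∈ S)

Consistent : ∀ {G p q} → Colouring G p q → Set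
Consistent {G} {p} {q} α =
  Σ (Fin (n G) → Fin q → Fin p) λ σ →
    (∀ x → IsOrdering (col α x) (σ x)) ×
    (∀ x y → Adj G x y → ∀ (i j : Fin q) → i ≢ j → σ x i ≢ σ y j)

data MonoReach {G : Graph} {p q : ℕ} (α : Colouring G p q) (β : Fin p)
       : Fin (n G) → Fin (n G) → Set where
  here : ∀ {x} → β ∈ col α x → MonoReach α β x x
  step : ∀ {x y z} → β ∈ col α x → Adj G x y → MonoReach α β y z → MonoReach α β x z

-- Clustering c: every monochromatic component has at most c vertices, i.e. any
-- list of distinct vertices in the monochromatic component of a vertex v has length ≤ c.
HasClustering : ∀ {G p q} → Colouring G p q → ℕ → Set
HasClustering {G} {p} α c =
  ∀ (β : Fin p) (v : Fin (n G)) (vs : List (Fin (n G))) →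
    Unique vs → All (MonoReach α β v) vs → length vs ≤ c

-- Vertex t of the path receives every colour except miss t = t mod (k+1).
-- Orderings are propagated along the path: passing from t to t+1, the slot that
-- held the newly missing colour miss (t+1) takes over the colour miss t that just
-- became available, and every other slot keeps its colour; so two adjacent
-- vertices never share a colour in different slots.  For a colour β, the vertices
-- lacking β are those with t ≡ β (mod k+1), so a monochromatic component lies
-- inside one gap between them, which has k vertices.
module Submission where

open import Defs
open import Data.Nat using (ℕ; zero; suc; _+_; _*_; _∸_; _≤_; _<_; z≤n; s≤s; s≤s⁻¹)
open import Data.Nat.Properties
  using (+-suc; +-comm; +-assoc; +-cancelˡ-≡; +-cancelʳ-≡; *-cancelʳ-≡; m∸n+n≡m; ≤∧≢⇒<; n<1+n)
open import Data.Nat.DivMod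
  using (_%_; _/_; _mod_; m≡m%n+[m/n]*n; m%n<n; [m+n]%n≡m%n; [m+kn]%n≡m%n; %-distribˡ-+; m<n⇒m%n≡m)
open import Data.Fin using (Fin; toℕ; fromℕ<; punchIn; punchOut)
open import Data.Fin.Properties
  using (toℕ-injective; toℕ-fromℕ<; toℕ<n; toℕ≤pred[n];
         punchIn-injective; punchInᵢ≢i; punchIn-punchOut; punchOut-injective)
  renaming (_≟_ to _≟ᶠ_)
open import Data.Fin.Subset using (Subset; ∁; ⁅_⁆; _∈_; ∣_∣)
open import Data.Fin.Subset.Properties
  using (x∈∁p⇒x∉p; x∉p⇒x∈∁p; x∉⁅y⁆⇒x≢y; x≢y⇒x∉⁅y⁆; ∣∁p∣≡n∸∣p∣; ∣⁅x⁆∣≡1)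
open import Data.List using ([]; _∷_; length)
open import Data.List.Relation.Unary.All using (All; []; _∷_; zip)
open import Data.List.Relation.Unary.AllPairs using (_∷_)
open import Data.List.Relation.Unary.Unique.Propositional using (Unique)
open import Data.Product using (Σ; ∃; _×_; _,_)
open import Data.Sum using (_⊎_; inj₁; inj₂)
open import Function using (_∘_)
open import Function.Definitions using (Injective)
open import Relation.Nullary using (yes; no; contradiction)
open import Relation.Binary.PropositionalEquality

Unique-length≤ : ∀ {A : Set} {P : A → Set} {k} (key : ∀ {x} → P x → Fin k) →
  (∀ {x y} (px : P x) (py : P y) → key px ≡ key py → x ≡ y) →
  ∀ {xs} → Unique xs → All P xs → length xs ≤ k
Unique-length≤ key key-inj {[]} _ _ = z≤n
Unique-length≤ {k = zero} key key-inj {_ ∷ _} _ (px ∷ _) with key px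
... | ()
Unique-length≤ {P = P} {k = suc k} key key-inj {x ∷ _} (x≢xs ∷ uniq) (px ∷ pxs) =
  s≤s (Unique-length≤ key′ key′-inj uniq (zip (pxs , x≢xs)))
  where
  key≢ : ∀ {y} (py : P y) → x ≢ y → key px ≢ key py
  key≢ py x≢y = x≢y ∘ key-inj px py
  key′ : ∀ {y} → P y × x ≢ y → Fin k
  key′ (py , x≢y) = punchOut (key≢ py x≢y)
  key′-inj : ∀ {y z} (qy : P y × x ≢ y) (qz : P z × x ≢ z) → key′ qy ≡ key′ qz → y ≡ z
  key′-inj (py , x≢y) (pz , x≢z) eq =
    key-inj py pz (punchOut-injective (key≢ py x≢y) (key≢ pz x≢z) eq)

∈∁⁅⁆⇒≢ : ∀ {n} {x y : Fin n} → x ∈ ∁ ⁅ y ⁆ → x ≢ y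
∈∁⁅⁆⇒≢ = x∉⁅y⁆⇒x≢y ∘ x∈∁p⇒x∉p

≢⇒∈∁⁅⁆ : ∀ {n} {x y : Fin n} → x ≢ y → x ∈ ∁ ⁅ y ⁆
≢⇒∈∁⁅⁆ = x∉p⇒x∈∁p ∘ x≢y⇒x∉⁅y⁆

replace : ∀ {n} → Fin n → Fin n → Fin n → Fin n
replace b a c with c ≟ᶠ b
... | yes _ = a
... | no _ = c

replace-cases : ∀ {n} (b a c : Fin n) →
  (c ≡ b × replace b a c ≡ a) ⊎ (c ≢ b × replace b a c ≡ c)
replace-cases b a c with c ≟ᶠ b
... | yes c≡b = inj₁ (c≡b , refl)
... | no c≢b = inj₂ (c≢b , refl)

replace-self : ∀ {n} (b a : Fin n) → replace b a b ≡ a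
replace-self b a with replace-cases b a b
... | inj₁ (_ , rb≡a) = rb≡a
... | inj₂ (b≢b , _) = contradiction refl b≢b

record OrdersAllBut {k} (a : Fin (suc k)) (σ : Fin k → Fin (suc k)) : Set where
  field
    injective : Injective _≡_ _≡_ σ
    avoids    : ∀ i → σ i ≢ a
    covers    : ∀ c → c ≢ a → ∃ λ i → σ i ≡ c

OrdersAllBut⇒IsOrdering : ∀ {k a} {σ : Fin k → Fin (suc k)} →
  OrdersAllBut a σ → IsOrdering (∁ ⁅ a ⁆) σ
OrdersAllBut⇒IsOrdering ord =
  injective , (λ c → covers c ∘ ∈∁⁅⁆⇒≢) , (≢⇒∈∁⁅⁆ ∘ avoids)
  where open OrdersAllBut ord

punchIn-ordersAllBut : ∀ {k} (a : Fin (suc k)) → OrdersAllBut a (punchIn a)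
punchIn-ordersAllBut a = record
  { injective = punchIn-injective a _ _
  ; avoids    = punchInᵢ≢i a
  ; covers    = λ c c≢a → punchOut (c≢a ∘ sym) , punchIn-punchOut (c≢a ∘ sym)
  }

module _ {k} {a b : Fin (suc k)} {σ : Fin k → Fin (suc k)} (ord : OrdersAllBut a σ) where
  open OrdersAllBut ord

  replace-ordersAllBut : OrdersAllBut b (replace b a ∘ σ)
  replace-ordersAllBut = record { injective = inj ; avoids = avd ; covers = cov }
    where
    inj : Injective _≡_ _≡_ (replace b a ∘ σ)
    inj {i} {j} eq with replace-cases b a (σ i) | replace-cases b a (σ j)
    ... | inj₁ (σi≡b , _) | inj₁ (σj≡b , _) = injective (trans σi≡b (sym σj≡b))
    ... | inj₁ (_ , ri≡a) | inj₂ (_ , rj≡σj) =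
      contradiction (trans (sym rj≡σj) (trans (sym eq) ri≡a)) (avoids j)
    ... | inj₂ (_ , ri≡σi) | inj₁ (_ , rj≡a) =
      contradiction (trans (sym ri≡σi) (trans eq rj≡a)) (avoids i)
    ... | inj₂ (_ , ri≡σi) | inj₂ (_ , rj≡σj) = injective (trans (sym ri≡σi) (trans eq rj≡σj))

    avd : ∀ i → replace b a (σ i) ≢ b
    avd i with replace-cases b a (σ i)
    ... | inj₁ (σi≡b , ri≡a) = λ ri≡b → avoids i (trans σi≡b (trans (sym ri≡b) ri≡a))
    ... | inj₂ (σi≢b , ri≡σi) = σi≢b ∘ trans (sym ri≡σi)

    cov : ∀ c → c ≢ b → ∃ λ i → replace b a (σ i) ≡ c
    cov c c≢b with c ≟ᶠ a
    ... | yes c≡a with covers b (c≢b ∘ trans c≡a ∘ sym)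
    ...   | i , σi≡b = i , trans (cong (replace b a) σi≡b) (trans (replace-self b a) (sym c≡a))
    cov c c≢b | no c≢a with covers c c≢a
    ...   | i , σi≡c with replace-cases b a (σ i)
    ...     | inj₁ (σi≡b , _) = contradiction (trans (sym σi≡c) σi≡b) c≢b
    ...     | inj₂ (_ , ri≡σi) = i , trans ri≡σi σi≡c

  replace-separates : ∀ {i j} → i ≢ j → σ i ≢ replace b a (σ j)
  replace-separates {i} {j} i≢j eq with replace-cases b a (σ j)
  ... | inj₁ (_ , rj≡a) = avoids i (trans eq rj≡a)
  ... | inj₂ (_ , rj≡σj) = i≢j (injective (trans eq rj≡σj))

module _ {k} (miss : ℕ → Fin (suc k)) where

  missingColouring : (m : ℕ) → Colouring (Path m) (suc k) k
  missingColouring m = record { col = col′ ; size = size′ }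
    where
    col′ : Fin m → Subset (suc k)
    col′ x = ∁ ⁅ miss (toℕ x) ⁆
    size′ : ∀ x → ∣ col′ x ∣ ≡ k
    size′ x = trans (∣∁p∣≡n∸∣p∣ ⁅ miss (toℕ x) ⁆) (cong (suc k ∸_) (∣⁅x⁆∣≡1 (miss (toℕ x))))

  ordering : ℕ → Fin k → Fin (suc k)
  ordering zero = punchIn (miss 0)
  ordering (suc t) = replace (miss (suc t)) (miss t) ∘ ordering t

  ordering-ordersAllBut : ∀ t → OrdersAllBut (miss t) (ordering t)
  ordering-ordersAllBut zero = punchIn-ordersAllBut (miss 0)
  ordering-ordersAllBut (suc t) = replace-ordersAllBut (ordering-ordersAllBut t)

  missingColouring-consistent : ∀ m → Consistent (missingColouring m)
  missingColouring-consistent m =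
    (ordering ∘ toℕ) , (OrdersAllBut⇒IsOrdering ∘ ordering-ordersAllBut ∘ toℕ) , separated
    where
    separated : ∀ x y → pathAdj m x y → ∀ i j → i ≢ j → ordering (toℕ x) i ≢ ordering (toℕ y) j
    separated x y (inj₁ y≡1+x) i j i≢j rewrite y≡1+x =
      replace-separates (ordering-ordersAllBut (toℕ x)) i≢j
    separated x y (inj₂ x≡1+y) i j i≢j rewrite x≡1+y =
      replace-separates (ordering-ordersAllBut (toℕ y)) (i≢j ∘ sym) ∘ sym

module _ {k : ℕ} where

  %-suc : ∀ m → m % suc k ≢ k → suc m % suc k ≡ suc (m % suc k)
  %-suc m m%n≢k = begin
    suc m % suc k                                 ≡⟨ cong (λ t → suc t % suc k) (m≡m%n+[m/n]*n m (suc k)) ⟩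
    (suc (m % suc k) + m / suc k * suc k) % suc k ≡⟨ [m+kn]%n≡m%n (suc (m % suc k)) (m / suc k) (suc k) ⟩
    suc (m % suc k) % suc k                       ≡⟨ m<n⇒m%n≡m (s≤s (≤∧≢⇒< (s≤s⁻¹ (m%n<n m (suc k))) m%n≢k)) ⟩
    suc (m % suc k)                               ∎
    where open ≡-Reasoning

  /-suc : ∀ m → m % suc k ≢ k → suc m / suc k ≡ m / suc k
  /-suc m m%n≢k =
    *-cancelʳ-≡ (suc m / suc k) (m / suc k) (suc k) (+-cancelˡ-≡ (suc (m % suc k)) _ _ (begin
    suc (m % suc k) + suc m / suc k * suc k ≡⟨ cong (_+ suc m / suc k * suc k) (%-suc m m%n≢k) ⟨
    suc m % suc k + suc m / suc k * suc k   ≡⟨ m≡m%n+[m/n]*n (suc m) (suc k) ⟨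
    suc m                                   ≡⟨ cong suc (m≡m%n+[m/n]*n m (suc k)) ⟩
    suc (m % suc k) + m / suc k * suc k     ∎))
    where open ≡-Reasoning

module _ {G : Graph} {p q} {α : Colouring G p q} {β : Fin p} where

  MonoReach-source : ∀ {v w} → MonoReach α β v w → β ∈ col α v
  MonoReach-source (here β∈v) = β∈v
  MonoReach-source (step β∈v _ _) = β∈v

  MonoReach-target : ∀ {v w} → MonoReach α β v w → β ∈ col α w
  MonoReach-target (here β∈w) = β∈w
  MonoReach-target (step _ _ rest) = MonoReach-target rest

  MonoReach-invariant : ∀ {A : Set} (f : Fin (n G) → A) →
    (∀ {x y} → β ∈ col α x → β ∈ col α y → Adj G x y → f x ≡ f y) →
    ∀ {v w} → MonoReach α β v w → f v ≡ f w
  MonoReach-invariant f f-adj (here _) = refl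
  MonoReach-invariant f f-adj (step β∈v v~x rest) =
    trans (f-adj β∈v (MonoReach-source rest) v~x) (MonoReach-invariant f f-adj rest)

module _ (k : ℕ) where

  cyclic : ℕ → Fin (suc k)
  cyclic t = t mod suc k

  module _ (β : Fin (suc k)) where

    -- The shift makes the vertices lacking β exactly those of phase k, and then
    -- block t is the number of vertices before t that lack β.
    shift : ℕ
    shift = k ∸ toℕ β

    phase : ℕ → ℕ
    phase t = (t + shift) % suc k

    block : ℕ → ℕ
    block t = (t + shift) / suc k

    phase≡k⇒cyclic≡β : ∀ t → phase t ≡ k → cyclic t ≡ β
    phase≡k⇒cyclic≡β t phase≡k = toℕ-injective (begin
      toℕ (cyclic t)                      ≡⟨ toℕ-fromℕ< (m%n<n t (suc k)) ⟩
      t % suc k                           ≡⟨ [m+n]%n≡m%n t (suc k) ⟨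
      (t + suc k) % suc k                 ≡⟨ cong (_% suc k) t+n≡t+shift+1+b ⟩
      (t + shift + suc b) % suc k         ≡⟨ %-distribˡ-+ (t + shift) (suc b) (suc k) ⟩
      (phase t + suc b % suc k) % suc k   ≡⟨ cong (λ r → (r + suc b % suc k) % suc k) phase≡k%n ⟩
      (k % suc k + suc b % suc k) % suc k ≡⟨ %-distribˡ-+ k (suc b) (suc k) ⟨
      (k + suc b) % suc k                 ≡⟨ cong (_% suc k) k+1+b≡b+n ⟩
      (b + suc k) % suc k                 ≡⟨ [m+n]%n≡m%n b (suc k) ⟩
      b % suc k                           ≡⟨ m<n⇒m%n≡m (toℕ<n β) ⟩
      b                                   ∎)
      where
      open ≡-Reasoning
      b : ℕ
      b = toℕ β
      t+n≡t+shift+1+b : t + suc k ≡ t + shift + suc b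
      t+n≡t+shift+1+b = trans (cong (t +_) (sym shift+1+b≡n)) (sym (+-assoc t shift (suc b)))
        where
        shift+1+b≡n : shift + suc b ≡ suc k
        shift+1+b≡n = trans (+-suc shift b) (cong suc (m∸n+n≡m (toℕ≤pred[n] β)))
      phase≡k%n : phase t ≡ k % suc k
      phase≡k%n = trans phase≡k (sym (m<n⇒m%n≡m (n<1+n k)))
      k+1+b≡b+n : k + suc b ≡ b + suc k
      k+1+b≡b+n = trans (+-suc k b) (trans (cong suc (+-comm k b)) (sym (+-suc b k)))

    β≢cyclic⇒phase≢k : ∀ t → β ≢ cyclic t → phase t ≢ k
    β≢cyclic⇒phase≢k t β≢ = β≢ ∘ sym ∘ phase≡k⇒cyclic≡β t

    β≢cyclic⇒phase<k : ∀ t → β ≢ cyclic t → phase t < k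
    β≢cyclic⇒phase<k t β≢ = ≤∧≢⇒< (s≤s⁻¹ (m%n<n (t + shift) (suc k))) (β≢cyclic⇒phase≢k t β≢)

    block-suc : ∀ t → β ≢ cyclic t → block (suc t) ≡ block t
    block-suc t β≢ = /-suc (t + shift) (β≢cyclic⇒phase≢k t β≢)

    phase-block-injective : ∀ {s t} → phase s ≡ phase t → block s ≡ block t → s ≡ t
    phase-block-injective {s} {t} phase≡ block≡ = +-cancelʳ-≡ shift s t (begin
      s + shift                     ≡⟨ m≡m%n+[m/n]*n (s + shift) (suc k) ⟩
      phase s + block s * suc k     ≡⟨ cong₂ (λ r q → r + q * suc k) phase≡ block≡ ⟩
      phase t + block t * suc k     ≡⟨ m≡m%n+[m/n]*n (t + shift) (suc k) ⟨
      t + shift                     ∎)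
      where open ≡-Reasoning

  cyclic-clustering : ∀ m → HasClustering (missingColouring cyclic m) k
  cyclic-clustering m β v vs uniq reach = Unique-length≤ key key-inj uniq reach
    where
    Reach : Fin m → Set
    Reach = MonoReach (missingColouring cyclic m) β v
    β≢cyclic : ∀ {w} → Reach w → β ≢ cyclic (toℕ w)
    β≢cyclic = ∈∁⁅⁆⇒≢ ∘ MonoReach-target
    block-adj : ∀ {x y} → β ∈ ∁ ⁅ cyclic (toℕ x) ⁆ → β ∈ ∁ ⁅ cyclic (toℕ y) ⁆ → pathAdj m x y →
      block β (toℕ x) ≡ block β (toℕ y)
    block-adj {x} β∈x _ (inj₁ y≡1+x) =
      trans (sym (block-suc β (toℕ x) (∈∁⁅⁆⇒≢ β∈x))) (cong (block β) (sym y≡1+x))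
    block-adj {y = y} _ β∈y (inj₂ x≡1+y) =
      trans (cong (block β) x≡1+y) (block-suc β (toℕ y) (∈∁⁅⁆⇒≢ β∈y))
    key : ∀ {w} → Reach w → Fin k
    key {w} r = fromℕ< (β≢cyclic⇒phase<k β (toℕ w) (β≢cyclic r))
    key-inj : ∀ {w w′} (r : Reach w) (r′ : Reach w′) → key r ≡ key r′ → w ≡ w′
    key-inj r r′ key≡ = toℕ-injective (phase-block-injective β
      (trans (sym (toℕ-fromℕ< _)) (trans (cong toℕ key≡) (toℕ-fromℕ< _)))
      (trans (sym (MonoReach-invariant (block β ∘ toℕ) block-adj r))
             (MonoReach-invariant (block β ∘ toℕ) block-adj r′)))

mainTheorem9 : (k m : ℕ) →
    Σ (Colouring (Path m) (suc k) k) λ α → Consistent α × HasClustering α k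
mainTheorem9 k m =
  missingColouring (cyclic k) m , missingColouring-consistent (cyclic k) m , cyclic-clustering k m
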